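{- There is a recursive sequence of recursive graphs $\langle G_i : i\in\mathbb{N}\rangle$ such that $0'$ is recursive in the set $\{i\in\mathbb{N} : G_i \text{ is colorable}\}$.
   Context: A graph $G=\langle V,E\rangle$ has vertex set $V\subseteq\mathbb{N}$ and edge set $E$ a set of unordered pairs of elements of $V$. $G$ is colorable if for some $k\in\mathbb{N}$ there is a function $\chi:V\to\{0,\dots,k-1\}$ with $\chi(x)\ne\chi(y)$ whenever $(x,y)\in E$. $0'$ denotes the halting set (Turing jump of a recursive set). -}

module Defs where

open import Data.Nat using (ℕ; zero; suc; _+_; _<_)
open import Data.Bool using (Bool; true; false; T; if_then_else_)
open import Data.Fin using (Fin)
open import Data.Product using (Σ; _×_; _,_; proj₁; proj₂)
open import Relation.Nullary using (¬_)
open import Relation.Binary.PropositionalEquality using (_≡_; _≢_)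

tri : ℕ → ℕ
tri zero    = zero
tri (suc n) = suc n + tri n

pair : ℕ → ℕ → ℕ
pair x y = tri (x + y) + y

unpair : ℕ → ℕ × ℕ
unpair zero = (0 , 0)
unpair (suc n) with unpair n
... | (zero  , y) = (suc y , 0)
... | (suc x , y) = (x , suc y)

-- Partial recursive functions (unary, multi-argument via pairing),
-- relativised to a total oracle O : ℕ → ℕ.

data Code : Set where
  zeroC succC idC leftC rightC oracleC : Code
  pairC compC primC : Code → Code → Code
  minC : Code → Code

-- Big-step semantics:  Eval O c x y  means  φ_c^O(x) ↓ = y.
data Eval (O : ℕ → ℕ) : Code → ℕ → ℕ → Set where
  ezero   : ∀ {x} → Eval O zeroC x 0
  esucc   : ∀ {x} → Eval O succC x (suc x)
  eid     : ∀ {x} → Eval O idC x x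
  eleft   : ∀ {x} → Eval O leftC x (proj₁ (unpair x))
  eright  : ∀ {x} → Eval O rightC x (proj₂ (unpair x))
  eoracle : ∀ {x} → Eval O oracleC x (O x)
  epair   : ∀ {f g x a b} → Eval O f x a → Eval O g x b →
            Eval O (pairC f g) x (pair a b)
  ecomp   : ∀ {f g x y z} → Eval O g x y → Eval O f y z →
            Eval O (compC f g) x z
  eprimZ  : ∀ {f g p x y} → unpair p ≡ (x , 0) → Eval O f x y →
            Eval O (primC f g) p y
  eprimS  : ∀ {f g p x n r y} → unpair p ≡ (x , suc n) →
            Eval O (primC f g) (pair x n) r →
            Eval O g (pair x (pair n r)) y →
            Eval O (primC f g) p y
  emin    : ∀ {f x n} → Eval O f (pair x n) 0 →
            (∀ m → m < n → Σ ℕ λ k → Eval O f (pair x m) (suc k)) →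
            Eval O (minC f) x n

-- Unrelativised computation (the oracle is never informative).
noOracle : ℕ → ℕ
noOracle _ = 0

decodeF : ℕ → ℕ → Code
decodeF zero     _ = zeroC
decodeF (suc fu) n with unpair n
... | (0 , _) = zeroC
... | (1 , _) = succC
... | (2 , _) = idC
... | (3 , _) = leftC
... | (4 , _) = rightC
... | (5 , _) = oracleC
... | (6 , r) = pairC (decodeF fu (proj₁ (unpair r))) (decodeF fu (proj₂ (unpair r)))
... | (7 , r) = compC (decodeF fu (proj₁ (unpair r))) (decodeF fu (proj₂ (unpair r)))
... | (8 , r) = primC (decodeF fu (proj₁ (unpair r))) (decodeF fu (proj₂ (unpair r)))
... | (9 , r) = minC (decodeF fu r)
... | _       = zeroC

decode : ℕ → Code
decode n = decodeF n n

Halting : ℕ → Set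
Halting e = Σ ℕ λ y → Eval noOracle (decode e) e y

bit : Bool → ℕ
bit b = if b then 1 else 0

IsChar : (ℕ → Set) → (ℕ → Bool) → Set
IsChar S χ = ∀ n → (T (χ n) → S n) × (S n → T (χ n))

RecursiveIn : (ℕ → Set) → (ℕ → Set) → Set
RecursiveIn A S = Σ Code λ r → ∀ χ → IsChar S χ →
  ∀ n → (A n → Eval (λ m → bit (χ m)) r n 1) ×
        (¬ A n → Eval (λ m → bit (χ m)) r n 0)

ComputesTotal : Code → (ℕ → ℕ) → Set
ComputesTotal c f = ∀ x → Eval noOracle c x (f x)

-- Graphs: vertex set given by V : ℕ → Bool, edge relation by E.
-- E must be symmetric, irreflexive and only relate vertices of V
-- (edges are unordered pairs of distinct elements of V).

IsGraph : (ℕ → Bool) → (ℕ → ℕ → Bool) → Set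
IsGraph V E = ∀ x y → T (E x y) →
  T (V x) × T (V y) × T (E y x) × x ≢ y

Colorable : (ℕ → Bool) → (ℕ → ℕ → Bool) → Set
Colorable V E = Σ ℕ λ k → Σ ((x : ℕ) → T (V x) → Fin k) λ χ →
  ∀ x y (vx : T (V x)) (vy : T (V y)) → T (E x y) → χ x vx ≢ χ y vy

-- A recursive sequence of recursive graphs ⟨G_i : i ∈ ℕ⟩:
-- G_i = ⟨ {x : V i x} , {{x,y} : E i x y} ⟩ where the maps
-- ⟨i , x⟩ ↦ V i x and ⟨i , ⟨x , y⟩⟩ ↦ E i x y are computed by programs.
RecursiveGraphSeq : (ℕ → ℕ → Bool) → (ℕ → ℕ → ℕ → Bool) → Set
RecursiveGraphSeq V E =
  (∀ i → IsGraph (V i) (E i)) ×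
  (Σ Code λ cV → ComputesTotal cV
      (λ p → bit (V (proj₁ (unpair p)) (proj₂ (unpair p))))) ×
  (Σ Code λ cE → ComputesTotal cE
      (λ p → bit (E (proj₁ (unpair p))
                    (proj₁ (unpair (proj₂ (unpair p))))
                    (proj₂ (unpair (proj₂ (unpair p)))))))

-- G_e has vertex set ℕ, and distinct x and y are adjacent iff numbers below both x and y
-- include a certificate that φ_e(e) halts.  If φ_e(e) halts, the vertices above its first
-- certificate form an infinite clique, and pigeonhole on k + 1 of them rules out every
-- k-colouring; if it diverges, G_e has no edges and one colour suffices.  So 0' is the
-- complement of {e : G_e colourable}, decided with a single oracle query.
-- A certificate codes a finite list of judgements φ_c(x) = y, each following by one
-- evaluation rule from judgements on the list.  Checking a certificate is primitive
-- recursive, which makes the edge relation recursive, and φ_c(x) converges iff some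
-- certificate claims it: soundness by induction on (code, input), completeness by induction
-- on the evaluation.

{-# OPTIONS --safe #-}
module Submission where

open import Defs
open import Algebra.Core using (Op₂)
open import Algebra.Structures using (IsMonoid)
open import Function using (_∘_; Equivalence)
open import Data.Bool using (Bool; true; false; T; not; _∧_; _∨_; if_then_else_)
open import Data.Bool.ListAction using (any; all)
open import Data.Bool.Properties using (T-∧; T-∨; T-≡; ∨-isMonoid; ∧-isMonoid)
open import Data.Empty using (⊥-elim)
open import Data.Fin using (Fin; zero; toℕ)
open import Data.Fin.Properties using (pigeonhole)
open import Data.List using (List; []; _∷_; _++_; foldr; map; length)
open import Data.List.Membership.Propositional using (_∈_; find)
open import Data.List.Relation.Binary.Subset.Propositional using (_⊆_)
open import Data.List.Relation.Binary.Subset.Propositional.Properties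
  using (⊆-refl; ⊆-trans; xs⊆xs++ys; xs⊆ys++xs; xs⊆x∷xs)
open import Data.List.Relation.Unary.All using (All; []; _∷_; lookupAny)
open import Data.List.Relation.Unary.All.Properties using (++⁺; all⁺; all⁻)
open import Data.List.Relation.Unary.Any as Any using (Any; here)
open import Data.List.Relation.Unary.Any.Properties using (any⁺; any⁻)
open import Data.Nat
open import Data.Nat.GeneralisedArithmetic using (fold; iterate; iterate-is-fold)
open import Data.Nat.Induction using (<-rec)
open import Data.Nat.Properties
open import Data.Product using (Σ; _×_; _,_; proj₁; proj₂; ∃-syntax; curry)
open import Data.Sum using (inj₁; inj₂)
open import Relation.Binary.PropositionalEquality
open import Relation.Nullary using (¬_)

open Equivalence using (to; from)

-- Cantor pairing

left right : ℕ → ℕ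
left  n = proj₁ (unpair n)
right n = proj₂ (unpair n)

pair-suc : ∀ x y → pair x (suc y) ≡ suc (pair (suc x) y)
pair-suc x y rewrite +-suc x y = +-suc (tri (suc (x + y))) y

pair-zero : ∀ x → pair (suc x) 0 ≡ suc (pair 0 x)
pair-zero x rewrite +-identityʳ x | +-identityʳ (x + tri x) = cong suc (+-comm x (tri x))

unpair-pair : ∀ x y → unpair (pair x y) ≡ (x , y)
unpair-pair x y = go _ x y refl
  where
  go : ∀ n x y → pair x y ≡ n → unpair n ≡ (x , y)
  go zero    zero    zero    _ = refl
  go zero    zero    (suc y) e with () ← trans (sym (pair-suc 0 y)) e
  go zero    (suc x) zero    e with () ← trans (sym (pair-zero x)) e
  go zero    (suc x) (suc y) e with () ← trans (sym (pair-suc (suc x) y)) e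
  go (suc n) zero    zero    ()
  go (suc n) x       (suc y) e
    rewrite go n (suc x) y (suc-injective (trans (sym (pair-suc x y)) e)) = refl
  go (suc n) (suc x) zero    e
    rewrite go n 0 x (suc-injective (trans (sym (pair-zero x)) e)) = refl

left-pair : ∀ x y → left (pair x y) ≡ x
left-pair x y = cong proj₁ (unpair-pair x y)

right-pair : ∀ x y → right (pair x y) ≡ y
right-pair x y = cong proj₂ (unpair-pair x y)

pair-unpair : ∀ n → pair (left n) (right n) ≡ n
pair-unpair zero = refl
pair-unpair (suc n) with unpair n | pair-unpair n
... | zero  , y | p = trans (pair-zero y) (cong suc p)
... | suc x , y | p = trans (pair-suc x y) (cong suc p)

unpair≡⇒≡pair : ∀ {n x y} → unpair n ≡ (x , y) → n ≡ pair x y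
unpair≡⇒≡pair {n} e = trans (sym (pair-unpair n)) (cong (λ (x , y) → pair x y) e)

n≤tri : ∀ n → n ≤ tri n
n≤tri zero    = z≤n
n≤tri (suc n) = m≤m+n (suc n) (tri n)

x≤pair : ∀ x y → x ≤ pair x y
x≤pair x y = ≤-trans (m≤m+n x y) (≤-trans (n≤tri (x + y)) (m≤m+n _ y))

y≤pair : ∀ x y → y ≤ pair x y
y≤pair x y = m≤n+m y _

y<pair : ∀ {x} y → 0 < x → y < pair x y
y<pair {x} y 0<x = +-monoˡ-≤ y (≤-trans (≤-trans 0<x (m≤m+n x y)) (n≤tri (x + y)))

pair-<-suc : ∀ x k → pair x k < pair x (suc k)
pair-<-suc x k rewrite pair-suc x k = s≤s (+-monoˡ-≤ k (m≤n+m (tri (x + k)) (suc (x + k))))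

left-≤ : ∀ n → left n ≤ n
left-≤ n = subst (left n ≤_) (pair-unpair n) (x≤pair (left n) (right n))

right-≤ : ∀ n → right n ≤ n
right-≤ n = subst (right n ≤_) (pair-unpair n) (y≤pair (left n) (right n))

right-< : ∀ n → 0 < left n → right n < n
right-< n 0<l = subst (right n <_) (pair-unpair n) (y<pair (right n) 0<l)

-- Programs with verified codes

infixr 5 _⊗_
data Ty : Set where
  nat bool : Ty
  _⊗_      : Ty → Ty → Ty

⟦_⟧ : Ty → Set
⟦ nat ⟧   = ℕ
⟦ bool ⟧  = Bool
⟦ s ⊗ t ⟧ = ⟦ s ⟧ × ⟦ t ⟧

encode : (s : Ty) → ⟦ s ⟧ → ℕ
encode nat     n       = n
encode bool    b       = bit b
encode (s ⊗ t) (a , b) = pair (encode s a) (encode t b)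

record Program (s t : Ty) : Set where
  constructor program
  field
    code : Code
    run  : ⟦ s ⟧ → ⟦ t ⟧
    eval : ∀ {O} v → Eval O code (encode s v) (encode t (run v))
open Program public

private variable s t u : Ty

computing : (f : ⟦ s ⟧ → ⟦ t ⟧) (p : Program s t) → (∀ v → run p v ≡ f v) → Program s t
computing {s} {t} f p p≗f = program (code p) f
  (λ {O} v → subst (Eval O (code p) (encode s v) ∘ encode t) (p≗f v) (eval p v))

idᴾ : Program s s
idᴾ = program idC (λ v → v) (λ _ → eid)

infixr 9 _∘ᴾ_
_∘ᴾ_ : Program t u → Program s t → Program s u
f ∘ᴾ g = program (compC (code f) (code g)) (run f ∘ run g)
  (λ v → ecomp (eval g v) (eval f (run g v)))

⟨_,_⟩ᴾ : Program s t → Program s u → Program s (t ⊗ u)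
⟨ f , g ⟩ᴾ = program (pairC (code f) (code g)) (λ v → run f v , run g v)
  (λ v → epair (eval f v) (eval g v))

fstᴾ : Program (s ⊗ t) s
fstᴾ {s} {t} = program leftC proj₁
  (λ {O} (a , b) → subst (Eval O leftC _) (left-pair (encode s a) (encode t b)) eleft)

sndᴾ : Program (s ⊗ t) t
sndᴾ {s} {t} = program rightC proj₂
  (λ {O} (a , b) → subst (Eval O rightC _) (right-pair (encode s a) (encode t b)) eright)

leftᴾ : Program nat nat
leftᴾ = program leftC left (λ _ → eleft)

rightᴾ : Program nat nat
rightᴾ = program rightC right (λ _ → eright)

pairᴾ : Program s nat → Program s nat → Program s nat
pairᴾ p q = program (code ⟨ p , q ⟩ᴾ) (λ v → pair (run p v) (run q v)) (eval ⟨ p , q ⟩ᴾ)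

sucᴾ : Program nat nat
sucᴾ = program succC suc (λ _ → esucc)

constᴾ : ℕ → Program s nat
constᴾ zero    = program zeroC (λ _ → 0) (λ _ → ezero)
constᴾ (suc n) = sucᴾ ∘ᴾ constᴾ n

falseᴾ : Program s bool
falseᴾ = program zeroC (λ _ → false) (λ _ → ezero)

trueᴾ : Program s bool
trueᴾ = program (code (constᴾ {nat} 1)) (λ _ → true) (eval (constᴾ 1))

bitᴾ : Program (s ⊗ bool) (s ⊗ nat)
bitᴾ = program idC (λ (v , b) → v , bit b) (λ _ → eid)

primRec : {A B : Set} → (A → B) → (A × ℕ × B → B) → A × ℕ → B
primRec f g (a , zero)  = f a
primRec f g (a , suc n) = g (a , n , primRec f g (a , n))

primRecᴾ : Program s t → Program (s ⊗ nat ⊗ t) t → Program (s ⊗ nat) t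
primRecᴾ {s} {t} f g = program (primC (code f) (code g)) (primRec (run f) (run g)) evaluates
  where
  evaluates : ∀ {O} v → Eval O (primC (code f) (code g)) (encode (s ⊗ nat) v)
                                 (encode t (primRec (run f) (run g) v))
  evaluates (a , zero)  = eprimZ (unpair-pair (encode s a) 0) (eval f a)
  evaluates (a , suc n) = eprimS (unpair-pair (encode s a) (suc n)) (evaluates (a , n))
                                 (eval g (a , n , primRec (run f) (run g) (a , n)))

-- Primitive recursion on bit b: zero steps give the else branch, one step the then branch.
if-then-elseᴾ : Program (bool ⊗ t ⊗ t) t
if-then-elseᴾ = computing (λ (b , x , y) → if b then x else y)
  (primRecᴾ sndᴾ (fstᴾ ∘ᴾ fstᴾ) ∘ᴾ bitᴾ ∘ᴾ ⟨ sndᴾ , fstᴾ ⟩ᴾ)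
  (λ { (true , _) → refl ; (false , _) → refl })

infix 0 ifᴾ_then_else_
ifᴾ_then_else_ : Program s bool → Program s t → Program s t → Program s t
ifᴾ b then p else q = if-then-elseᴾ ∘ᴾ ⟨ b , ⟨ p , q ⟩ᴾ ⟩ᴾ

notᴾ : Program bool bool
notᴾ = computing not (ifᴾ idᴾ then falseᴾ else trueᴾ) λ { true → refl ; false → refl }

infixr 6 _∧ᴾ_
infixr 5 _∨ᴾ_
_∧ᴾ_ _∨ᴾ_ : Program s bool → Program s bool → Program s bool
p ∧ᴾ q = computing (λ v → run p v ∧ run q v) (ifᴾ p then q else falseᴾ) (λ v → ∧-as-if (run p v))
  where
  ∧-as-if : ∀ a {b} → (if a then b else false) ≡ a ∧ b
  ∧-as-if true  = refl
  ∧-as-if false = refl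
p ∨ᴾ q = computing (λ v → run p v ∨ run q v) (ifᴾ p then trueᴾ else q) (λ v → ∨-as-if (run p v))
  where
  ∨-as-if : ∀ a {b} → (if a then true else b) ≡ a ∨ b
  ∨-as-if true  = refl
  ∨-as-if false = refl

isZeroᴾ : Program nat bool
isZeroᴾ = computing (_≡ᵇ 0) (primRecᴾ trueᴾ falseᴾ ∘ᴾ ⟨ constᴾ 0 , idᴾ ⟩ᴾ)
  λ { zero → refl ; (suc _) → refl }

predᴾ : Program nat nat
predᴾ = computing pred (primRecᴾ (constᴾ 0) (fstᴾ ∘ᴾ sndᴾ) ∘ᴾ ⟨ constᴾ 0 , idᴾ ⟩ᴾ)
  λ { zero → refl ; (suc _) → refl }

monusᴾ : Program (nat ⊗ nat) nat
monusᴾ = computing (λ (a , b) → a ∸ b) (primRecᴾ idᴾ (predᴾ ∘ᴾ sndᴾ ∘ᴾ sndᴾ))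
  (λ (a , b) → iterated-pred a b)
  where
  iterated-pred : ∀ a b → primRec (λ a → a) (λ (_ , _ , d) → pred d) (a , b) ≡ a ∸ b
  iterated-pred a zero    = refl
  iterated-pred a (suc b) = trans (cong pred (iterated-pred a b)) (pred[m∸n]≡m∸[1+n] a b)

infix 7 _≡ᴾ_
_≡ᴾ_ : Program s nat → Program s nat → Program s bool
p ≡ᴾ q = computing (λ v → run p v ≡ᵇ run q v)
  (isZeroᴾ ∘ᴾ monusᴾ ∘ᴾ ⟨ p , q ⟩ᴾ ∧ᴾ isZeroᴾ ∘ᴾ monusᴾ ∘ᴾ ⟨ q , p ⟩ᴾ)
  (λ v → both-∸-zero (run p v) (run q v))
  where
  both-∸-zero : ∀ a b → ((a ∸ b) ≡ᵇ 0) ∧ ((b ∸ a) ≡ᵇ 0) ≡ (a ≡ᵇ b)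
  both-∸-zero zero    zero    = refl
  both-∸-zero zero    (suc b) = refl
  both-∸-zero (suc a) zero    = refl
  both-∸-zero (suc a) (suc b) = both-∸-zero a b

-- Bounded quantifiers and lists coded by numbers

foldBelow : {A : Set} → Op₂ A → A → (ℕ → A) → ℕ → A
foldBelow _⊕_ ε f zero    = ε
foldBelow _⊕_ ε f (suc n) = foldBelow _⊕_ ε f n ⊕ f n

anyBelow allBelow : (ℕ → Bool) → ℕ → Bool
anyBelow = foldBelow _∨_ false
allBelow = foldBelow _∧_ true

anyBelow⁺ : ∀ {f n} j → j < n → T (f j) → T (anyBelow f n)
anyBelow⁺ {f} {suc n} j j<1+n fj with m<1+n⇒m<n∨m≡n j<1+n
... | inj₁ j<n  = T-∨ .from (inj₁ (anyBelow⁺ j j<n fj))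
... | inj₂ refl = T-∨ .from (inj₂ fj)

anyBelow⁻ : ∀ {f} n → T (anyBelow f n) → ∃[ j ] j < n × T (f j)
anyBelow⁻ {f} (suc n) p with T-∨ .to p
... | inj₁ q = let j , j<n , fj = anyBelow⁻ n q in j , m<n⇒m<1+n j<n , fj
... | inj₂ q = n , n<1+n n , q

allBelow⁺ : ∀ {f} n → (∀ j → j < n → T (f j)) → T (allBelow f n)
allBelow⁺ zero    all = _
allBelow⁺ (suc n) all = T-∧ .from (allBelow⁺ n (λ j → all j ∘ m<n⇒m<1+n) , all n (n<1+n n))

allBelow⁻ : ∀ {f n} → T (allBelow f n) → ∀ j → j < n → T (f j)
allBelow⁻ {f} {suc n} p j j<1+n with T-∧ .to p | m<1+n⇒m<n∨m≡n j<1+n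
... | below , _ | inj₁ j<n  = allBelow⁻ below j j<n
... | _ , at    | inj₂ refl = at

listOf : ℕ → ℕ → List ℕ
listOf zero    L = []
listOf (suc B) L = left L ∷ listOf B (right L)

entries : ℕ → List ℕ
entries l = listOf (left l) (right l)

encodeList : List ℕ → ℕ
encodeList ns = pair (length ns) (foldr pair 0 ns)

entries-encodeList : ∀ ns → entries (encodeList ns) ≡ ns
entries-encodeList ns
  rewrite left-pair (length ns) (foldr pair 0 ns) | right-pair (length ns) (foldr pair 0 ns) =
  listOf-foldr ns
  where
  listOf-foldr : ∀ ns → listOf (length ns) (foldr pair 0 ns) ≡ ns
  listOf-foldr []       = refl
  listOf-foldr (n ∷ ns) rewrite left-pair n (foldr pair 0 ns) | right-pair n (foldr pair 0 ns) =
    cong (n ∷_) (listOf-foldr ns)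

entry : ℕ → ℕ → ℕ
entry L j = left (iterate right L j)

module _ {A : Set} {_⊕_ : Op₂ A} {ε : A} (monoid : IsMonoid _≡_ _⊕_ ε) where
  open IsMonoid monoid using (assoc; identityˡ; identityʳ)

  foldBelow-suc : ∀ f n → foldBelow _⊕_ ε f (suc n) ≡ f 0 ⊕ foldBelow _⊕_ ε (f ∘ suc) n
  foldBelow-suc f zero    = trans (identityˡ (f 0)) (sym (identityʳ (f 0)))
  foldBelow-suc f (suc n) =
    trans (cong (_⊕ f (suc n)) (foldBelow-suc f n)) (assoc (f 0) _ (f (suc n)))

  foldr-listOf : ∀ (f : ℕ → A) B L →
                 foldr _⊕_ ε (map f (listOf B L)) ≡ foldBelow _⊕_ ε (f ∘ entry L) B
  foldr-listOf f zero    L = refl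
  foldr-listOf f (suc B) L =
    trans (cong (f (left L) ⊕_) (foldr-listOf f B (right L))) (sym (foldBelow-suc (f ∘ entry L) B))

entryᴾ : Program (nat ⊗ nat) nat
entryᴾ = computing (λ (L , j) → entry L j) (leftᴾ ∘ᴾ primRecᴾ idᴾ (rightᴾ ∘ᴾ sndᴾ ∘ᴾ sndᴾ))
  (λ (L , j) → cong left (trans (primRec-fold L j) (iterate-is-fold L right j)))
  where
  primRec-fold : ∀ L j → primRec (λ L → L) (λ (_ , _ , a) → right a) (L , j) ≡ fold L right j
  primRec-fold L zero    = refl
  primRec-fold L (suc j) = cong right (primRec-fold L j)

foldBelowᴾ : Program (bool ⊗ bool) bool → Program s bool
           → Program (s ⊗ nat) bool → Program (s ⊗ nat) bool
foldBelowᴾ {s} op e p =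
  computing (λ (v , n) → foldBelow (curry (run op)) (run e v) (λ j → run p (v , j)) n)
    (primRecᴾ e step) (λ (v , n) → unfold v n)
  where
  step : Program (s ⊗ nat ⊗ bool) bool
  step = op ∘ᴾ ⟨ sndᴾ ∘ᴾ sndᴾ , p ∘ᴾ ⟨ fstᴾ , fstᴾ ∘ᴾ sndᴾ ⟩ᴾ ⟩ᴾ
  unfold : ∀ v n → primRec (run e) (run step) (v , n)
                 ≡ foldBelow (curry (run op)) (run e v) (λ j → run p (v , j)) n
  unfold v zero    = refl
  unfold v (suc n) = cong (λ a → run op (a , run p (v , n))) (unfold v n)

anyBelowᴾ allBelowᴾ : Program (s ⊗ nat) bool → Program (s ⊗ nat) bool
anyBelowᴾ = foldBelowᴾ (fstᴾ ∨ᴾ sndᴾ) falseᴾ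
allBelowᴾ = foldBelowᴾ (fstᴾ ∧ᴾ sndᴾ) trueᴾ

private
  atEntry : Program (s ⊗ nat) bool → Program ((s ⊗ nat) ⊗ nat) bool
  atEntry p = p ∘ᴾ ⟨ fstᴾ ∘ᴾ fstᴾ , entryᴾ ∘ᴾ ⟨ rightᴾ ∘ᴾ sndᴾ ∘ᴾ fstᴾ , sndᴾ ⟩ᴾ ⟩ᴾ

anyEntriesᴾ allEntriesᴾ : Program (s ⊗ nat) bool → Program (s ⊗ nat) bool
anyEntriesᴾ p = computing (λ (v , l) → any (λ n → run p (v , n)) (entries l))
  (anyBelowᴾ (atEntry p) ∘ᴾ ⟨ idᴾ , leftᴾ ∘ᴾ sndᴾ ⟩ᴾ)
  (λ (v , l) → sym (foldr-listOf ∨-isMonoid _ (left l) (right l)))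
allEntriesᴾ p = computing (λ (v , l) → all (λ n → run p (v , n)) (entries l))
  (allBelowᴾ (atEntry p) ∘ᴾ ⟨ idᴾ , leftᴾ ∘ᴾ sndᴾ ⟩ᴾ)
  (λ (v , l) → sym (foldr-listOf ∧-isMonoid _ (left l) (right l)))

-- Certificates of computations

data Decodes : ℕ → ℕ → Code → Set where
  zeroD   : ∀ {r} → Decodes 0 r zeroC
  succD   : ∀ {r} → Decodes 1 r succC
  idD     : ∀ {r} → Decodes 2 r idC
  leftD   : ∀ {r} → Decodes 3 r leftC
  rightD  : ∀ {r} → Decodes 4 r rightC
  oracleD : ∀ {r} → Decodes 5 r oracleC
  pairD   : ∀ {r} → Decodes 6 r (pairC (decode (left r)) (decode (right r)))
  compD   : ∀ {r} → Decodes 7 r (compC (decode (left r)) (decode (right r)))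
  primD   : ∀ {r} → Decodes 8 r (primC (decode (left r)) (decode (right r)))
  minD    : ∀ {r} → Decodes 9 r (minC (decode r))
  junkD   : ∀ {r} t → Decodes (10 + t) r zeroC

child≤ : ∀ {n t r f m} → unpair n ≡ (suc t , r) → n ≤ suc f → m ≤ r → m ≤ f
child≤ {n} {r = r} u n≤1+f m≤r = ≤-pred (≤-trans (s≤s m≤r) (≤-trans r<n n≤1+f))
  where
  r<n : r < n
  r<n = subst (_< n) (cong proj₂ u) (right-< n (subst (0 <_) (sym (cong proj₁ u)) z<s))

decodeF-stable : ∀ {f g} n → n ≤ f → n ≤ g → decodeF f n ≡ decodeF g n
decodeF-stable {zero}  {zero}  _ _   _   = refl
decodeF-stable {zero}  {suc g} _ z≤n _   = refl
decodeF-stable {suc f} {zero}  _ _   z≤n = refl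
decodeF-stable {suc f} {suc g} n n≤f n≤g with unpair n in u
... | 0 , _ = refl
... | 1 , _ = refl
... | 2 , _ = refl
... | 3 , _ = refl
... | 4 , _ = refl
... | 5 , _ = refl
... | 6 , r = cong₂ pairC (decodeF-stable _ (child≤ u n≤f (left-≤ r)) (child≤ u n≤g (left-≤ r)))
                         (decodeF-stable _ (child≤ u n≤f (right-≤ r)) (child≤ u n≤g (right-≤ r)))
... | 7 , r = cong₂ compC (decodeF-stable _ (child≤ u n≤f (left-≤ r)) (child≤ u n≤g (left-≤ r)))
                         (decodeF-stable _ (child≤ u n≤f (right-≤ r)) (child≤ u n≤g (right-≤ r)))
... | 8 , r = cong₂ primC (decodeF-stable _ (child≤ u n≤f (left-≤ r)) (child≤ u n≤g (left-≤ r)))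
                         (decodeF-stable _ (child≤ u n≤f (right-≤ r)) (child≤ u n≤g (right-≤ r)))
... | 9 , r = cong minC (decodeF-stable _ (child≤ u n≤f ≤-refl) (child≤ u n≤g ≤-refl))
... | suc (suc (suc (suc (suc (suc (suc (suc (suc (suc _))))))))) , _ = refl

decodeF-child : ∀ {m t r n} → unpair (suc m) ≡ (suc t , r) → n ≤ r → decodeF m n ≡ decode n
decodeF-child {m} u n≤r = decodeF-stable _ (child≤ {f = m} u ≤-refl n≤r) ≤-refl

decodeF-children : ∀ {m t r} (k : Code → Code → Code) → unpair (suc m) ≡ (suc t , r)
                 → k (decodeF m (left r)) (decodeF m (right r)) ≡ k (decode (left r)) (decode (right r))
decodeF-children {m} k u = cong₂ k (decodeF-child {m} u (left-≤ _)) (decodeF-child {m} u (right-≤ _))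

decodes : ∀ c → Decodes (left c) (right c) (decode c)
decodes zero    = zeroD
decodes (suc m) with unpair (suc m) in u
... | 0 , _ = zeroD
... | 1 , _ = succD
... | 2 , _ = idD
... | 3 , _ = leftD
... | 4 , _ = rightD
... | 5 , _ = oracleD
... | 6 , r = subst (Decodes 6 r) (sym (decodeF-children {m} pairC u)) pairD
... | 7 , r = subst (Decodes 7 r) (sym (decodeF-children {m} compC u)) compD
... | 8 , r = subst (Decodes 8 r) (sym (decodeF-children {m} primC u)) primD
... | 9 , r = subst (Decodes 9 r ∘ minC) (sym (decodeF-child {m} u ≤-refl)) minD
... | suc (suc (suc (suc (suc (suc (suc (suc (suc (suc t))))))))) , _ = junkD t

-- The judgement ⟨c , ⟨x , ⟨y , h⟩⟩⟩ asserts φ_c(x) = y; the hint h is the intermediate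
-- value of a composition or of a recursion step.
judgement : ℕ → ℕ → ℕ → ℕ → ℕ
judgement c x y h = pair c (pair x (pair y h))

codeOf inputOf outputOf hintOf : ℕ → ℕ
codeOf   n = left n
inputOf  n = left (right n)
outputOf n = left (right (right n))
hintOf   n = right (right (right n))

records : ℕ → ℕ → ℕ → ℕ → Bool
records n c x y = (codeOf n ≡ᵇ c) ∧ (inputOf n ≡ᵇ x) ∧ (outputOf n ≡ᵇ y)

recordsPositive : ℕ → ℕ → ℕ → Bool
recordsPositive n c x = (codeOf n ≡ᵇ c) ∧ (inputOf n ≡ᵇ x) ∧ not (outputOf n ≡ᵇ 0)

claims : List ℕ → ℕ → ℕ → ℕ → Bool
claims ns c x y = any (λ n → records n c x y) ns

claimsPositive : List ℕ → ℕ → ℕ → Bool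
claimsPositive ns c x = any (λ n → recordsPositive n c x) ns

primStepValid : List ℕ → (c r x₀ k y h : ℕ) → Bool
primStepValid ns c r x₀ zero    y h = claims ns (left r) x₀ y
primStepValid ns c r x₀ (suc k) y h =
  claims ns c (pair x₀ k) h ∧ claims ns (right r) (pair x₀ (pair k h)) y

-- The evaluation rule for c = ⟨t , r⟩, with premises claimed by ns.  The oracle (tag 5)
-- of an unrelativised computation answers 0.
validAt : List ℕ → (t r c x y h : ℕ) → Bool
validAt ns 0 r c x y h = y ≡ᵇ 0
validAt ns 1 r c x y h = y ≡ᵇ suc x
validAt ns 2 r c x y h = y ≡ᵇ x
validAt ns 3 r c x y h = y ≡ᵇ left x
validAt ns 4 r c x y h = y ≡ᵇ right x
validAt ns 5 r c x y h = y ≡ᵇ 0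
validAt ns 6 r c x y h = claims ns (left r) x (left y) ∧ claims ns (right r) x (right y)
validAt ns 7 r c x y h = claims ns (right r) x h ∧ claims ns (left r) h y
validAt ns 8 r c x y h = primStepValid ns c r (left x) (right x) y h
validAt ns 9 r c x y h = claims ns r (pair x y) 0 ∧ allBelow (λ m → claimsPositive ns r (pair x m)) y
validAt ns _ r c x y h = y ≡ᵇ 0

valid : List ℕ → ℕ → Bool
valid ns n =
  validAt ns (left (codeOf n)) (right (codeOf n)) (codeOf n) (inputOf n) (outputOf n) (hintOf n)

≡ᵇ-refl : ∀ n → T (n ≡ᵇ n)
≡ᵇ-refl n = ≡⇒≡ᵇ n n refl

records⇒≡ : ∀ {n c x y} → T (records n c x y) → codeOf n ≡ c × inputOf n ≡ x × outputOf n ≡ y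
records⇒≡ r = let c , r′ = T-∧ .to r ; x , y = T-∧ .to r′ in ≡ᵇ⇒≡ _ _ c , ≡ᵇ⇒≡ _ _ x , ≡ᵇ⇒≡ _ _ y

recordsPositive⇒ : ∀ {n c x} → T (recordsPositive n c x)
                 → codeOf n ≡ c × inputOf n ≡ x × ∃[ k ] outputOf n ≡ suc k
recordsPositive⇒ {n} r = let c , r′ = T-∧ .to r ; x , y = T-∧ .to r′ in
  ≡ᵇ⇒≡ _ _ c , ≡ᵇ⇒≡ _ _ x , positive (outputOf n) y
  where
  positive : ∀ y → T (not (y ≡ᵇ 0)) → ∃[ k ] y ≡ suc k
  positive (suc k) _ = k , refl

∈⇒claims : ∀ {n ns} → n ∈ ns → T (claims ns (codeOf n) (inputOf n) (outputOf n))
∈⇒claims n∈ns = any⁺ _ (Any.map (λ { {n} refl → records-self n }) n∈ns)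
  where
  records-self : ∀ n → T (records n (codeOf n) (inputOf n) (outputOf n))
  records-self n =
    T-∧ .from (≡ᵇ-refl (codeOf n) , T-∧ .from (≡ᵇ-refl (inputOf n) , ≡ᵇ-refl (outputOf n)))

module _ {ns : List ℕ} (justified : All (T ∘ valid ns) ns) where

  private
    Sound : ℕ → Set
    Sound c = ∀ x {y} → T (claims ns c x y) → Eval noOracle (decode c) x y

    justification : ∀ {c x y} → T (claims ns c x y) → ∃[ h ] T (validAt ns (left c) (right c) c x y h)
    justification {c} {x} {y} p =
      let i = any⁻ _ ns p ; v , r = lookupAny justified i in
      _ , at {Any.lookup i} (records⇒≡ {Any.lookup i} {c} {x} {y} r) v
      where
      at : ∀ {n c x y} → codeOf n ≡ c × inputOf n ≡ x × outputOf n ≡ y → T (valid ns n)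
         → T (validAt ns (left c) (right c) c x y (hintOf n))
      at (refl , refl , refl) v = v

    positive : ∀ {c x} → Sound c → T (claimsPositive ns c x) → ∃[ k ] Eval noOracle (decode c) x (suc k)
    positive {c} {x} sound p =
      let n , n∈ns , r = find (any⁻ _ ns p) in at sound n∈ns (recordsPositive⇒ {n} {c} {x} r)
      where
      at : ∀ {n c x} → Sound c → n ∈ ns → codeOf n ≡ c × inputOf n ≡ x × ∃[ k ] outputOf n ≡ suc k
         → ∃[ k ] Eval noOracle (decode c) x (suc k)
      at sound n∈ns (refl , refl , k , o) = k , subst (Eval noOracle _ _) o (sound _ (∈⇒claims n∈ns))

    sound-at : ∀ {t r C c x y h} → Decodes t r C
      → (0 < t → ∀ {c′} → c′ ≤ r → Sound c′)
      → (∀ {x′} → x′ < x → ∀ {y′} → T (claims ns c x′ y′) → Eval noOracle C x′ y′)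
      → T (validAt ns t r c x y h) → Eval noOracle C x y
    sound-at {y = y}       zeroD     _ _ v rewrite ≡ᵇ⇒≡ y 0         v = ezero
    sound-at {x = x} {y} succD     _ _ v rewrite ≡ᵇ⇒≡ y (suc x)   v = esucc
    sound-at {x = x} {y} idD       _ _ v rewrite ≡ᵇ⇒≡ y x         v = eid
    sound-at {x = x} {y} leftD     _ _ v rewrite ≡ᵇ⇒≡ y (left x)  v = eleft
    sound-at {x = x} {y} rightD    _ _ v rewrite ≡ᵇ⇒≡ y (right x) v = eright
    sound-at {y = y}       oracleD   _ _ v rewrite ≡ᵇ⇒≡ y 0         v = eoracle
    sound-at {y = y}       (junkD _) _ _ v rewrite ≡ᵇ⇒≡ y 0         v = ezero
    sound-at {r = r} {x = x} {y} pairD sub _ v =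
      let v₁ , v₂ = T-∧ .to v in
      subst (Eval noOracle _ x) (pair-unpair y)
        (epair (sub z<s (left-≤ r) x v₁) (sub z<s (right-≤ r) x v₂))
    sound-at {r = r} compD sub _ v =
      let v₁ , v₂ = T-∧ .to v in
      ecomp (sub z<s (right-≤ r) _ v₁) (sub z<s (left-≤ r) _ v₂)
    sound-at {r = r} {x = x} primD sub earlier v with unpair x in u
    ... | x₀ , zero  = eprimZ u (sub z<s (left-≤ r) x₀ v)
    ... | x₀ , suc k =
      let v₁ , v₂ = T-∧ .to v in
      eprimS u (earlier (subst (pair x₀ k <_) (sym (unpair≡⇒≡pair u)) (pair-<-suc x₀ k)) v₁)
               (sub z<s (right-≤ r) _ v₂)
    sound-at minD sub _ v =
      let v₁ , v₂ = T-∧ .to v in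
      emin (sub z<s ≤-refl _ v₁) (λ m m<y → positive (sub z<s ≤-refl) (allBelow⁻ v₂ m m<y))

  -- Lexicographic induction on (c , x): the subcodes of c = ⟨t , r⟩ are at most r < c, and
  -- the recursive premise of a primC step has a smaller input.
  claims-sound : ∀ c x {y} → T (claims ns c x y) → Eval noOracle (decode c) x y
  claims-sound = <-rec Sound λ c sound-below → <-rec _ λ x sound-before {y} p →
    let _ , v = justification {c} {x} {y} p in
    sound-at (decodes c) (λ 0<t c′≤r → sound-below (≤-<-trans c′≤r (right-< c 0<t))) sound-before v

ValidInExtensions : List ℕ → Set
ValidInExtensions ns = ∀ {ms} → ns ⊆ ms → All (T ∘ valid ms) ns

-- Validity and the conclusion are required in every extension of the list, so that
-- certificates can be merged by concatenation.
record Certified (P : List ℕ → Set) : Set where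
  constructor certified
  field
    judgements  : List ℕ
    justified   : ValidInExtensions judgements
    establishes : ∀ {ms} → judgements ⊆ ms → P ms

private variable P Q : List ℕ → Set

trivially : (∀ ms → P ms) → Certified P
trivially p = certified [] (λ _ → []) (λ {ms} _ → p ms)

mapᶜ : (∀ ms → P ms → Q ms) → Certified P → Certified Q
mapᶜ f (certified ns just est) = certified ns just (λ {ms} ⊆ms → f ms (est ⊆ms))

both : Certified P → Certified Q → Certified (λ ms → P ms × Q ms)
both (certified ns jn pn) (certified ks jk qk) = certified (ns ++ ks)
  (λ ⊆ms → ++⁺ (jn (⊆-trans (xs⊆xs++ys ns ks) ⊆ms)) (jk (⊆-trans (xs⊆ys++xs ks ns) ⊆ms)))
  (λ ⊆ms → pn (⊆-trans (xs⊆xs++ys ns ks) ⊆ms) , qk (⊆-trans (xs⊆ys++xs ks ns) ⊆ms))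

certify-below : ∀ {P : ℕ → List ℕ → Set} n → (∀ m → m < n → Certified (P m))
              → Certified (λ ms → ∀ m → m < n → P m ms)
certify-below zero    _    = trivially (λ _ _ ())
certify-below {P} (suc n) cert =
  mapᶜ extend (both (certify-below n (λ m → cert m ∘ m<n⇒m<1+n)) (cert n (n<1+n n)))
  where
  extend : ∀ ms → (∀ m → m < n → P m ms) × P n ms → ∀ m → m < suc n → P m ms
  extend _ (below , at) m m<1+n with m<1+n⇒m<n∨m≡n m<1+n
  ... | inj₁ m<n  = below m m<n
  ... | inj₂ refl = at

Claimed : ℕ → ℕ → ℕ → List ℕ → Set
Claimed c x y ms = T (claims ms c x y)

valid-judgement : ∀ {ms c t r x y h} → unpair c ≡ (t , r) → T (validAt ms t r c x y h)
                → T (valid ms (judgement c x y h))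
valid-judgement {c = c} {x = x} {y} {h} u v
  rewrite unpair-pair c (pair x (pair y h)) | unpair-pair x (pair y h) | unpair-pair y h | u = v

judgement-claimed : ∀ {ms c x y h} → judgement c x y h ∈ ms → T (claims ms c x y)
judgement-claimed {ms} {c} {x} {y} {h} j∈ms with ∈⇒claims j∈ms
... | p rewrite unpair-pair c (pair x (pair y h)) | unpair-pair x (pair y h) | unpair-pair y h = p

conclude : ∀ {c t r x y} h → unpair c ≡ (t , r) → Certified (λ ms → T (validAt ms t r c x y h))
         → Certified (Claimed c x y)
conclude {c} {x = x} {y} h u (certified ns just v) = certified (judgement c x y h ∷ ns)
  (λ ⊆ms → valid-judgement u (v (tail ⊆ms)) ∷ just (tail ⊆ms))
  (λ ⊆ms → judgement-claimed (⊆ms (here refl)))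
  where
  tail : ∀ {ms} → judgement c x y h ∷ ns ⊆ ms → ns ⊆ ms
  tail = ⊆-trans (xs⊆x∷xs ns _)

claims⇒claimsPositive : ∀ {ms c x k} → T (claims ms c x (suc k)) → T (claimsPositive ms c x)
claims⇒claimsPositive {ms} {c} {x} {k} p = any⁺ _ (Any.map (λ {n} → positive {n}) (any⁻ _ ms p))
  where
  positive : ∀ {n} → T (records n c x (suc k)) → T (recordsPositive n c x)
  positive {n} r with records⇒≡ {n} {c} {x} {suc k} r
  ... | refl , refl , o rewrite o = T-∧ .from (≡ᵇ-refl (codeOf n) , T-∧ .from (≡ᵇ-refl (inputOf n) , _))

primStep-valid : ∀ {ms c r p x₀ k y h} → unpair p ≡ (x₀ , k) → T (primStepValid ms c r x₀ k y h)
               → T (validAt ms 8 r c p y h)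
primStep-valid u v rewrite u = v

complete : ∀ {C x y c t r} → Eval noOracle C x y → unpair c ≡ (t , r) → Decodes t r C
         → Certified (Claimed c x y)

complete-code : ∀ c {x y} → Eval noOracle (decode c) x y → Certified (Claimed c x y)
complete-code c d = complete d refl (decodes c)

complete         ezero   u zeroD     = conclude 0 u (trivially λ _ → _)
complete         ezero   u (junkD _) = conclude 0 u (trivially λ _ → _)
complete {x = x} esucc   u succD     = conclude 0 u (trivially λ _ → ≡ᵇ-refl (suc x))
complete {x = x} eid     u idD       = conclude 0 u (trivially λ _ → ≡ᵇ-refl x)
complete {x = x} eleft   u leftD     = conclude 0 u (trivially λ _ → ≡ᵇ-refl (left x))
complete {x = x} eright  u rightD    = conclude 0 u (trivially λ _ → ≡ᵇ-refl (right x))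
complete         eoracle u oracleD   = conclude 0 u (trivially λ _ → _)
complete {x = x} {c = c} {r = r} (epair {a = a} {b} d₁ d₂) u pairD =
  conclude 0 u (mapᶜ pair-valid (both (complete-code (left r) d₁) (complete-code (right r) d₂)))
  where
  pair-valid : ∀ ms → Claimed (left r) x a ms × Claimed (right r) x b ms
             → T (validAt ms 6 r c x (pair a b) 0)
  pair-valid _ p rewrite unpair-pair a b = T-∧ .from p
complete {r = r} (ecomp {y = y} d₁ d₂) u compD =
  conclude y u (mapᶜ (λ _ → T-∧ .from) (both (complete-code (right r) d₁) (complete-code (left r) d₂)))
complete {r = r} (eprimZ {p = p} v d) u primD =
  conclude 0 u (mapᶜ (λ _ → primStep-valid {p = p} v) (complete-code (left r) d))
complete {r = r} (eprimS {p = p} {r = r₀} v d₁ d₂) u primD =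
  conclude r₀ u (mapᶜ (λ _ → primStep-valid {p = p} v ∘ T-∧ .from)
                      (both (complete d₁ u primD) (complete-code (right r) d₂)))
complete {x = x} {r = r} (emin {n = n} d₀ below) u minD =
  conclude 0 u (mapᶜ (λ _ (p , q) → T-∧ .from (p , allBelow⁺ n q))
                     (both (complete-code r d₀) (certify-below n positive)))
  where
  positive : ∀ m → m < n → Certified (λ ms → T (claimsPositive ms r (pair x m)))
  positive m m<n with below m m<n
  ... | k , d = mapᶜ (λ ms → claims⇒claimsPositive {ms} {r} {pair x m} {k}) (complete-code r d)

allValid : List ℕ → Bool
allValid ns = all (valid ns) ns

certifies : ℕ → ℕ → Bool
certifies e w = allValid (entries (right w)) ∧ claims (entries (right w)) e e (left w)

certifies⇒halting : ∀ {e} w → T (certifies e w) → Halting e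
certifies⇒halting {e} w p =
  let justified , claimed = T-∧ {allValid (entries (right w))} .to p in
  left w , claims-sound {entries (right w)} (all⁺ _ _ justified) e e claimed

halting⇒certifies : ∀ {e} → Halting e → ∃[ w ] T (certifies e w)
halting⇒certifies {e} (y , d) with complete-code e d
... | certified ns justified establishes = pair y (encodeList ns) , certificate
  where
  certificate : T (certifies e (pair y (encodeList ns)))
  certificate
    rewrite left-pair y (encodeList ns) | right-pair y (encodeList ns) | entries-encodeList ns =
    T-∧ .from (all⁻ _ (justified ⊆-refl) , establishes ⊆-refl)

-- Checking certificates by a program

Env₄ Env₇ : Ty
Env₄ = nat ⊗ nat ⊗ nat ⊗ nat
Env₇ = nat ⊗ nat ⊗ nat ⊗ Env₄

codeOfᴾ inputOfᴾ outputOfᴾ hintOfᴾ : Program nat nat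
codeOfᴾ   = leftᴾ
inputOfᴾ  = leftᴾ ∘ᴾ rightᴾ
outputOfᴾ = leftᴾ ∘ᴾ rightᴾ ∘ᴾ rightᴾ
hintOfᴾ   = rightᴾ ∘ᴾ rightᴾ ∘ᴾ rightᴾ

claimsᴾ : Program Env₄ bool
claimsᴾ = anyEntriesᴾ recordsᴾ ∘ᴾ ⟨ sndᴾ , fstᴾ ⟩ᴾ
  where
  recordsᴾ : Program ((nat ⊗ nat ⊗ nat) ⊗ nat) bool
  recordsᴾ = codeOfᴾ ∘ᴾ sndᴾ ≡ᴾ fstᴾ ∘ᴾ fstᴾ
          ∧ᴾ inputOfᴾ ∘ᴾ sndᴾ ≡ᴾ fstᴾ ∘ᴾ sndᴾ ∘ᴾ fstᴾ
          ∧ᴾ outputOfᴾ ∘ᴾ sndᴾ ≡ᴾ sndᴾ ∘ᴾ sndᴾ ∘ᴾ fstᴾ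

claimsPositiveᴾ : Program (nat ⊗ nat ⊗ nat) bool
claimsPositiveᴾ = anyEntriesᴾ recordsPositiveᴾ ∘ᴾ ⟨ sndᴾ , fstᴾ ⟩ᴾ
  where
  recordsPositiveᴾ : Program ((nat ⊗ nat) ⊗ nat) bool
  recordsPositiveᴾ = codeOfᴾ ∘ᴾ sndᴾ ≡ᴾ fstᴾ ∘ᴾ fstᴾ
                  ∧ᴾ inputOfᴾ ∘ᴾ sndᴾ ≡ᴾ sndᴾ ∘ᴾ fstᴾ
                  ∧ᴾ notᴾ ∘ᴾ (outputOfᴾ ∘ᴾ sndᴾ ≡ᴾ constᴾ 0)

#0 #1 #2 #3 #4 #5 #6 : Program Env₇ nat
#0 = fstᴾ
#1 = fstᴾ ∘ᴾ sndᴾ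
#2 = fstᴾ ∘ᴾ sndᴾ ∘ᴾ sndᴾ
#3 = fstᴾ ∘ᴾ sndᴾ ∘ᴾ sndᴾ ∘ᴾ sndᴾ
#4 = fstᴾ ∘ᴾ sndᴾ ∘ᴾ sndᴾ ∘ᴾ sndᴾ ∘ᴾ sndᴾ
#5 = fstᴾ ∘ᴾ sndᴾ ∘ᴾ sndᴾ ∘ᴾ sndᴾ ∘ᴾ sndᴾ ∘ᴾ sndᴾ
#6 = sndᴾ ∘ᴾ sndᴾ ∘ᴾ sndᴾ ∘ᴾ sndᴾ ∘ᴾ sndᴾ ∘ᴾ sndᴾ

claimedᴾ : (c x y : Program Env₇ nat) → Program Env₇ bool
claimedᴾ c x y = claimsᴾ ∘ᴾ ⟨ #0 , ⟨ c , ⟨ x , y ⟩ᴾ ⟩ᴾ ⟩ᴾ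

primStepValidᴾ : Program Env₇ bool
primStepValidᴾ = computing (λ (l , c , r , x₀ , k , y , h) → primStepValid (entries l) c r x₀ k y h)
  (ifᴾ k ≡ᴾ constᴾ 0 then claimedᴾ (leftᴾ ∘ᴾ r) x₀ y
                     else claimedᴾ c (pairᴾ x₀ k-1) h
                       ∧ᴾ claimedᴾ (rightᴾ ∘ᴾ r) (pairᴾ x₀ (pairᴾ k-1 h)) y)
  (λ { (_ , _ , _ , _ , zero , _) → refl ; (_ , _ , _ , _ , suc _ , _) → refl })
  where
  c r x₀ k y h k-1 : Program Env₇ nat
  c = #1 ; r = #2 ; x₀ = #3 ; k = #4 ; y = #5 ; h = #6
  k-1 = predᴾ ∘ᴾ k

validAtᴾ : Program Env₇ bool
validAtᴾ = computing (λ (l , t , r , c , x , y , h) → validAt (entries l) t r c x y h) dispatch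
  (λ (l , t , r , c , x , y , h) → by-tag l t r c x y h)
  where
  dispatch : Program Env₇ bool
  dispatch =
    ifᴾ tag ≡ᴾ constᴾ 1 then y ≡ᴾ sucᴾ ∘ᴾ x else
    ifᴾ tag ≡ᴾ constᴾ 2 then y ≡ᴾ x else
    ifᴾ tag ≡ᴾ constᴾ 3 then y ≡ᴾ leftᴾ ∘ᴾ x else
    ifᴾ tag ≡ᴾ constᴾ 4 then y ≡ᴾ rightᴾ ∘ᴾ x else
    ifᴾ tag ≡ᴾ constᴾ 6 then claimedᴾ (leftᴾ ∘ᴾ r) x (leftᴾ ∘ᴾ y)
                          ∧ᴾ claimedᴾ (rightᴾ ∘ᴾ r) x (rightᴾ ∘ᴾ y) else
    ifᴾ tag ≡ᴾ constᴾ 7 then claimedᴾ (rightᴾ ∘ᴾ r) x h ∧ᴾ claimedᴾ (leftᴾ ∘ᴾ r) h y else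
    ifᴾ tag ≡ᴾ constᴾ 8 then primStep else
    ifᴾ tag ≡ᴾ constᴾ 9 then claimedᴾ r (pairᴾ x y) (constᴾ 0) ∧ᴾ minimality else
    y ≡ᴾ constᴾ 0
    where
    tag r c x y h : Program Env₇ nat
    tag = #1 ; r = #2 ; c = #3 ; x = #4 ; y = #5 ; h = #6
    primStep minimality : Program Env₇ bool
    primStep = primStepValidᴾ ∘ᴾ ⟨ #0 , ⟨ c , ⟨ r , ⟨ leftᴾ ∘ᴾ x , ⟨ rightᴾ ∘ᴾ x , ⟨ y , h ⟩ᴾ ⟩ᴾ ⟩ᴾ ⟩ᴾ ⟩ᴾ ⟩ᴾ
    minimality = allBelowᴾ (claimsPositiveᴾ ∘ᴾ ⟨ #0 ∘ᴾ fstᴾ , ⟨ r ∘ᴾ fstᴾ , pairᴾ (x ∘ᴾ fstᴾ) sndᴾ ⟩ᴾ ⟩ᴾ)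
              ∘ᴾ ⟨ idᴾ , y ⟩ᴾ

  by-tag : ∀ l t r c x y h → run dispatch (l , t , r , c , x , y , h) ≡ validAt (entries l) t r c x y h
  by-tag _ 0 _ _ _ _ _ = refl
  by-tag _ 1 _ _ _ _ _ = refl
  by-tag _ 2 _ _ _ _ _ = refl
  by-tag _ 3 _ _ _ _ _ = refl
  by-tag _ 4 _ _ _ _ _ = refl
  by-tag _ 5 _ _ _ _ _ = refl
  by-tag _ 6 _ _ _ _ _ = refl
  by-tag _ 7 _ _ _ _ _ = refl
  by-tag _ 8 _ _ _ _ _ = refl
  by-tag _ 9 _ _ _ _ _ = refl
  by-tag _ (suc (suc (suc (suc (suc (suc (suc (suc (suc (suc _)))))))))) _ _ _ _ _ = refl

validᴾ : Program (nat ⊗ nat) bool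
validᴾ = validAtᴾ ∘ᴾ ⟨ fstᴾ , ⟨ leftᴾ ∘ᴾ c , ⟨ rightᴾ ∘ᴾ c , ⟨ c
                   , ⟨ inputOfᴾ ∘ᴾ sndᴾ , ⟨ outputOfᴾ ∘ᴾ sndᴾ , hintOfᴾ ∘ᴾ sndᴾ ⟩ᴾ ⟩ᴾ ⟩ᴾ ⟩ᴾ ⟩ᴾ ⟩ᴾ
  where
  c : Program (nat ⊗ nat) nat
  c = codeOfᴾ ∘ᴾ sndᴾ

certifiesᴾ : Program (nat ⊗ nat) bool
certifiesᴾ = allEntriesᴾ validᴾ ∘ᴾ ⟨ judgementsᴾ , judgementsᴾ ⟩ᴾ
          ∧ᴾ claimsᴾ ∘ᴾ ⟨ judgementsᴾ , ⟨ fstᴾ , ⟨ fstᴾ , leftᴾ ∘ᴾ sndᴾ ⟩ᴾ ⟩ᴾ ⟩ᴾ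
  where
  judgementsᴾ : Program (nat ⊗ nat) nat
  judgementsᴾ = rightᴾ ∘ᴾ sndᴾ

-- The graphs

haltsBelow : ℕ → ℕ → Bool
haltsBelow e = anyBelow (certifies e)

edge : ℕ → ℕ → ℕ → Bool
edge e x y = not (x ≡ᵇ y) ∧ haltsBelow e x ∧ haltsBelow e y

edgeᴾ : Program nat bool
edgeᴾ = notᴾ ∘ᴾ (x ≡ᴾ y) ∧ᴾ haltsBelowᴾ ∘ᴾ ⟨ e , x ⟩ᴾ ∧ᴾ haltsBelowᴾ ∘ᴾ ⟨ e , y ⟩ᴾ
  where
  e x y : Program nat nat
  e = leftᴾ
  x = leftᴾ ∘ᴾ rightᴾ
  y = rightᴾ ∘ᴾ rightᴾ
  haltsBelowᴾ : Program (nat ⊗ nat) bool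
  haltsBelowᴾ = anyBelowᴾ certifiesᴾ

≢⇒not-≡ᵇ : ∀ {x y} → x ≢ y → T (not (x ≡ᵇ y))
≢⇒not-≡ᵇ {x} {y} x≢y with x ≡ᵇ y in eq
... | true  = x≢y (≡ᵇ⇒≡ x y (T-≡ .from eq))
... | false = _

not-≡ᵇ⇒≢ : ∀ {x y} → T (not (x ≡ᵇ y)) → x ≢ y
not-≡ᵇ⇒≢ {x} p refl = subst (T ∘ not) (T-≡ .to (≡ᵇ-refl x)) p

edge-isGraph : ∀ e → IsGraph (λ _ → true) (edge e)
edge-isGraph e x y p =
  let distinct , reached = T-∧ {not (x ≡ᵇ y)} .to p
      x-reached , y-reached = T-∧ {haltsBelow e x} .to reached
  in _ , _ , T-∧ .from (≢⇒not-≡ᵇ {y} {x} (not-≡ᵇ⇒≢ distinct ∘ sym) , T-∧ .from (y-reached , x-reached))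
   , not-≡ᵇ⇒≢ distinct

edgeless⇒colorable : ∀ {V E} → (∀ x y → ¬ T (E x y)) → Colorable V E
edgeless⇒colorable none = 1 , (λ _ _ → zero) , λ x y _ _ xy _ → none x y xy

clique⇒¬colorable : ∀ {V E} w → (∀ {x} → w ≤ x → T (V x))
                  → (∀ {x y} → w ≤ x → w ≤ y → x ≢ y → T (E x y)) → ¬ Colorable V E
clique⇒¬colorable w vertex adjacent (k , χ , proper) =
  let i , j , i<j , same = pigeonhole (n<1+n k) colour in
  proper _ _ _ _ (adjacent (m≤m+n w _) (m≤m+n w _) (λ eq → <-irrefl (+-cancelˡ-≡ w _ _ eq) i<j)) same
  where
  colour : Fin (suc k) → Fin k
  colour i = χ (w + toℕ i) (vertex (m≤m+n w (toℕ i)))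

halting⇒¬colorable : ∀ {e} → Halting e → ¬ Colorable (λ _ → true) (edge e)
halting⇒¬colorable h with halting⇒certifies h
... | w , certificate = clique⇒¬colorable (suc w) _ λ w<x w<y x≢y →
  T-∧ .from (≢⇒not-≡ᵇ x≢y , T-∧ .from (anyBelow⁺ w w<x certificate , anyBelow⁺ w w<y certificate))

¬halting⇒colorable : ∀ {e} → ¬ Halting e → Colorable (λ _ → true) (edge e)
¬halting⇒colorable {e} ¬h = edgeless⇒colorable λ x y p →
  let _ , reached = T-∧ {not (x ≡ᵇ y)} .to p
      w , _ , certificate = anyBelow⁻ x (proj₁ (T-∧ {haltsBelow e x} .to reached))
  in ¬h (certifies⇒halting w certificate)

complement-recursiveIn : ∀ {A S : ℕ → Set} → (∀ {n} → A n → ¬ S n) → (∀ {n} → ¬ A n → S n)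
                       → RecursiveIn A S
complement-recursiveIn {A} {S} A⇒¬S ¬A⇒S = negation , decides
  where
  negation : Code
  negation = compC (code notᴾ) oracleC
  decides : ∀ χ → IsChar S χ → ∀ n → (A n → Eval (λ m → bit (χ m)) negation n 1)
                                   × (¬ A n → Eval (λ m → bit (χ m)) negation n 0)
  decides χ char n with χ n | char n | ecomp {O = λ m → bit (χ m)} (eoracle {x = n}) (eval notᴾ (χ n))
  ... | true  | S-if , _ | negated = (λ a → ⊥-elim (A⇒¬S a (S-if _))) , λ _ → negated
  ... | false | _ , if-S | negated = (λ _ → negated) , λ ¬a → ⊥-elim (if-S (¬A⇒S ¬a))

corollary16 : Σ (ℕ → ℕ → Bool) λ V → Σ (ℕ → ℕ → ℕ → Bool) λ E →
    RecursiveGraphSeq V E × RecursiveIn Halting (λ i → Colorable (V i) (E i))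
corollary16 = (λ _ _ → true) , edge ,
  (edge-isGraph , (code (trueᴾ {nat}) , eval trueᴾ) , (code edgeᴾ , eval edgeᴾ)) ,
  complement-recursiveIn halting⇒¬colorable ¬halting⇒colorable
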